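{- Let $G$ be a hidden graph on vertex set $V$ accessible via an MIS oracle, and let $S\subseteq V$. The connected components of $G[S]$ can be computed with $\mathcal{O}(|S|^2)$ MIS queries, and there are instances where $\Omega(|S|^2)$ MIS queries are needed.
   Context: A maximal independent set (MIS) oracle for a graph $G$ on $V$, on query $T\subseteq V$, returns some maximal independent set of the induced subgraph $G[T]$, which may be chosen adversarially among all maximal independent sets of $G[T]$. Computing the connected components of $G[S]$ means outputting the partition of $S$ into the vertex sets of the connected components of $G[S]$, guaranteed correct from the query answers alone. -}

module Defs where

open import Data.Nat using (ℕ; zero; suc)
open import Data.Bool using (Bool; true; false)
open import Data.Fin using (Fin)
open import Data.Fin.Subset using (Subset; _∈_; _∉_; _⊆_)
open import Data.Product using (Σ; _×_)
open import Data.Empty using (⊥)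
open import Relation.Binary.PropositionalEquality using (_≡_)
open import Function.Bundles using (_⇔_)

record Graph (n : ℕ) : Set where
  field
    adj     : Fin n → Fin n → Bool
    sym     : ∀ u v → adj u v ≡ adj v u
    irrefl  : ∀ v → adj v v ≡ false
open Graph public

Adj : ∀ {n} → Graph n → Fin n → Fin n → Set
Adj G u v = adj G u v ≡ true

record IsMIS {n : ℕ} (G : Graph n) (T R : Subset n) : Set where
  field
    subset      : R ⊆ T
    independent : ∀ u v → u ∈ R → v ∈ R → Adj G u v → ⊥
    maximal     : ∀ v → v ∈ T → v ∉ R → Σ (Fin n) (λ u → u ∈ R × Adj G u v)

data Connected {n : ℕ} (G : Graph n) (S : Subset n) (u : Fin n) : Fin n → Set where
  here : u ∈ S → Connected G S u u
  step : ∀ {v w} → Connected G S u v → w ∈ S → Adj G v w → Connected G S u w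

-- An adaptive query algorithm (decision tree) over vertex set Fin n.
-- It either stops, outputting the partition of S as a "same block" relation,
-- or issues an MIS query T ⊆ V and continues depending on the answer.
data Alg (n : ℕ) : Set where
  done  : (Fin n → Fin n → Bool) → Alg n
  query : Subset n → (Subset n → Alg n) → Alg n

CorrectComponents : ∀ {n} → Graph n → Subset n → (Fin n → Fin n → Bool) → Set
CorrectComponents G S out =
  ∀ u v → u ∈ S → v ∈ S → (out u v ≡ true) ⇔ Connected G S u v

-- On hidden graph G, whatever (adversarially chosen) maximal independent set
-- the oracle returns to each query, the algorithm makes at most k queries and
-- outputs the correct components of G[S].
data SolvesWithin {n : ℕ} (G : Graph n) (S : Subset n) : Alg n → ℕ → Set where
  done  : ∀ {out k} → CorrectComponents G S out → SolvesWithin G S (done out) k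
  query : ∀ {T f k} →
          (∀ R → IsMIS G T R → SolvesWithin G S (f R) k) →
          SolvesWithin G S (query T f) (suc k)

{-# OPTIONS --safe #-}
-- Upper bound: the answer to the query {u, v} contains both u and v exactly when they are
-- non-adjacent, so |S|² pair queries reveal G[S], whose components are then computed offline.
-- Lower bound: let G₀ be two disjoint cliques of sizes ⌊m/2⌋ and ⌈m/2⌉, and G₀ + e the same
-- graph with one crossing edge e; all these graphs have different components from G₀. The
-- adversary answers every query T with a maximal independent set of G₀[T]. It holds at most one
-- vertex of each clique, so it is also a valid answer for every G₀ + e except at most one:
-- each query rules out at most one of the ⌊m/2⌋⌈m/2⌉ graphs G₀ + e.
module Submission where

open import Defs
open import Data.Bool using (Bool; true; false; not; _∧_; if_then_else_)
import Data.Bool as Bool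
open import Data.Fin using (Fin; zero; suc; _≟_; splitAt; _↑ˡ_; _↑ʳ_)
open import Data.Fin.Properties using (any?; splitAt-↑ˡ; splitAt-↑ʳ; ↑ˡ-injective; ↑ʳ-injective)
open import Data.Fin.Subset using (Subset; ∣_∣; _∈_; _∉_; _⊆_; ⁅_⁆; _∪_; ⊤) renaming (⊥ to ⊥ₛ)
open import Data.Fin.Subset.Properties
  using (_∈?_; ∉⊥; ∈⊤; ∣⊤∣≡n; p⊆p∪q; x∈⁅x⁆; x∈⁅y⁆⇒x≡y; x∈p∪q⁻; x∈p∪q⁺)
open import Data.List using (List; []; _∷_; _++_; length; map; filter; cartesianProduct; allFin)
open import Data.List.Membership.Propositional using () renaming (_∈_ to _∈ₗ_)
open import Data.List.Membership.Propositional.Properties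
  using (∈-map⁺; ∈-map⁻; ∈-cartesianProduct⁺; ∉[]; ∈-allFin)
open import Data.List.Properties using (length-map; length-++; length-tabulate; filter-all)
open import Data.List.Relation.Unary.All using (All; _∷_)
import Data.List.Relation.Unary.All as All
import Data.List.Relation.Unary.All.Properties as All
open import Data.List.Relation.Unary.AllPairs using ([]; _∷_)
open import Data.List.Relation.Unary.Any using (here; there)
open import Data.List.Relation.Unary.Unique.Propositional using (Unique)
import Data.List.Relation.Unary.Unique.Propositional.Properties as Unique
open import Data.Nat using (ℕ; suc; _+_; _*_; _^_; _≤_; s≤s; z≤n; ⌊_/2⌋; ⌈_/2⌉)
open import Data.Nat.Properties
  using (≤-refl; ≤-reflexive; ≤-trans; m≤m+n; +-identityʳ; *-identityˡ; ^-identityʳ;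
         +-monoˡ-≤; +-monoʳ-≤; *-mono-≤; *-monoʳ-≤; ⌊n/2⌋-mono; ⌊n/2⌋≤⌈n/2⌉; ⌊n/2⌋+⌈n/2⌉≡n;
         module ≤-Reasoning)
open import Data.Nat.Tactic.RingSolver using (solve-∀)
open import Data.Product using (Σ; ∃; _×_; _,_; proj₁; proj₂)
import Data.Product as Product
open import Data.Product.Properties using (≡-dec; ,-injectiveˡ; ,-injectiveʳ)
open import Data.Sum using (_⊎_; inj₁; inj₂; [_,_]′; swap)
import Data.Sum as Sum
open import Data.Vec using ([]; _∷_; lookup)
import Data.Vec as Vec
open import Data.Vec.Properties using ([]=⇒lookup; lookup⇒[]=)
open import Function using (_∘_; id; const; case_of_)
open import Function.Bundles using (_⇔_; mk⇔; Equivalence)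
open import Function.Construct.Composition using (_⇔-∘_)
open import Relation.Binary.PropositionalEquality
  using (_≡_; _≢_; refl; trans; cong; cong₂; subst; module ≡-Reasoning) renaming (sym to ≡-sym)
open import Relation.Nullary using (¬_; Dec; yes; no; does; ¬?; contradiction)
open import Relation.Nullary.Decidable
  using (map′; _×-dec_; _⊎-dec_; dec-false; does-⇔; decidable-stable)
open import Relation.Unary.Properties using (∁?)

does≡true⇔ : {A : Set} (a? : Dec A) → does a? ≡ true ⇔ A
does≡true⇔ (yes a) = mk⇔ (const a) (const refl)
does≡true⇔ (no ¬a) = mk⇔ (λ ()) (λ a → contradiction a ¬a)

module _ {n : ℕ} (G : Graph n) where

  adj-sym : ∀ {x y} → Adj G x y → Adj G y x
  adj-sym {x} {y} x~y = trans (sym G y x) x~y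

  adj-irrefl : ∀ {x} → ¬ Adj G x x
  adj-irrefl {x} x~x with () ← trans (≡-sym (irrefl G x)) x~x

  Independent : Subset n → Set
  Independent R = ∀ u v → u ∈ R → v ∈ R → ¬ Adj G u v

  Dominated : Subset n → Fin n → Set
  Dominated R v = ∃ λ u → u ∈ R × Adj G u v

module _ {n : ℕ} where

  fromRelation : {R : Fin n → Fin n → Set} → (∀ x y → Dec (R x y)) →
                 (∀ {x y} → R x y → R y x) → (∀ {x} → ¬ R x x) → Graph n
  fromRelation R? R-sym R-irrefl = record
    { adj    = λ x y → does (R? x y)
    ; sym    = λ x y → does-⇔ (mk⇔ R-sym R-sym) (R? x y) (R? y x)
    ; irrefl = λ x → dec-false (R? x x) R-irrefl
    }

  DistinctSameColour : (Fin n → Bool) → Fin n → Fin n → Set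
  DistinctSameColour c x y = x ≢ y × c x ≡ c y

  twoCliques : (Fin n → Bool) → Graph n
  twoCliques c = fromRelation {R = DistinctSameColour c} (λ x y → ¬? (x ≟ y) ×-dec c x Bool.≟ c y)
    (λ (x≢y , cx≡cy) → x≢y ∘ ≡-sym , ≡-sym cx≡cy)
    (λ (x≢x , _) → x≢x refl)

  Adj-twoCliques : ∀ c x y → Adj (twoCliques c) x y ⇔ DistinctSameColour c x y
  Adj-twoCliques c x y = does≡true⇔ (¬? (x ≟ y) ×-dec c x Bool.≟ c y)

  Joins : Fin n × Fin n → Fin n → Fin n → Set
  Joins (u , v) x y = x ≡ u × y ≡ v ⊎ x ≡ v × y ≡ u

  joins? : ∀ e x y → Dec (Joins e x y)
  joins? (u , v) x y = (x ≟ u ×-dec y ≟ v) ⊎-dec (x ≟ v ×-dec y ≟ u)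

  joins-sym : ∀ {e x y} → Joins e x y → Joins e y x
  joins-sym (inj₁ (x≡u , y≡v)) = inj₂ (y≡v , x≡u)
  joins-sym (inj₂ (x≡v , y≡u)) = inj₁ (y≡u , x≡v)

  -- Adding the edge uv is a no-op when u = v, so no distinctness proof is needed.
  AdjOrJoins : Graph n → Fin n × Fin n → Fin n → Fin n → Set
  AdjOrJoins G e x y = Adj G x y ⊎ x ≢ y × Joins e x y

  adjOrJoins? : ∀ G e x y → Dec (AdjOrJoins G e x y)
  adjOrJoins? G e x y = adj G x y Bool.≟ true ⊎-dec ¬? (x ≟ y) ×-dec joins? e x y

  _+edge_ : Graph n → Fin n × Fin n → Graph n
  G +edge e = fromRelation (adjOrJoins? G e)
    (λ { (inj₁ x~y) → inj₁ (adj-sym G x~y)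
       ; (inj₂ (x≢y , j)) → inj₂ (x≢y ∘ ≡-sym , joins-sym j) })
    (λ { (inj₁ x~x) → adj-irrefl G x~x
       ; (inj₂ (x≢x , _)) → x≢x refl })

  Adj-+edge : ∀ G e {x y} → Adj (G +edge e) x y ⇔ AdjOrJoins G e x y
  Adj-+edge G e {x} {y} = does≡true⇔ (adjOrJoins? G e x y)

data Walk {A : Set} (E : A → A → Set) (P : A → Set) (x : A) : A → Set where
  start : P x → Walk E P x x
  step  : ∀ {y z} → Walk E P x y → P z → E y z → Walk E P x z

module _ {A : Set} {E : A → A → Set} {P : A → Set} where

  walk-start : ∀ {x y} → Walk E P x y → P x
  walk-start (start p)    = p
  walk-start (step c _ _) = walk-start c

  walk-end : ∀ {x y} → Walk E P x y → P y
  walk-end (start p)    = p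
  walk-end (step _ p _) = p

  walk-++ : ∀ {x y z} → Walk E P x y → Walk E P y z → Walk E P x z
  walk-++ c (start _)    = c
  walk-++ c (step d p e) = step (walk-++ c d) p e

walk-map : ∀ {A : Set} {E F : A → A → Set} {P Q : A → Set} →
           (∀ {x} → P x → Q x) → (∀ {x y} → P x → P y → E x y → F x y) →
           ∀ {x y} → Walk E P x y → Walk F Q x y
walk-map f g (start p)    = start (f p)
walk-map f g (step c p e) = step (walk-map f g c) (f p) (g (walk-end c) p e)

Walk⇔Connected : ∀ {n} {G : Graph n} {S x y} → Walk (Adj G) (_∈ S) x y ⇔ Connected G S x y
Walk⇔Connected = mk⇔ to from
  where
  to : ∀ {n} {G : Graph n} {S x y} → Walk (Adj G) (_∈ S) x y → Connected G S x y
  to (start p)    = here p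
  to (step c p e) = step (to c) p e
  from : ∀ {n} {G : Graph n} {S x y} → Connected G S x y → Walk (Adj G) (_∈ S) x y
  from (here p)     = start p
  from (step c p e) = step (from c) p e

module DecideWalk {n : ℕ} {E : Fin n → Fin n → Set} (E? : ∀ x y → Dec (E x y)) where

  Reaches : List (Fin n) → Fin n → Fin n → Set
  Reaches L x w = x ≡ w ⊎ ∃ λ p → Walk E (_∈ₗ L) x p × E p w

  ReachedFrom : List (Fin n) → Fin n → Fin n → Set
  ReachedFrom L w y = y ≡ w ⊎ ∃ λ p → E w p × Walk E (_∈ₗ L) p y

  widen : ∀ {w L x y} → Walk E (_∈ₗ L) x y → Walk E (_∈ₗ w ∷ L) x y
  widen = walk-map there (λ _ _ e → e)

  walk-∷⁺ : ∀ {w L x y} → Walk E (_∈ₗ L) x y ⊎ Reaches L x w × ReachedFrom L w y →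
            Walk E (_∈ₗ w ∷ L) x y
  walk-∷⁺ (inj₁ c) = widen c
  walk-∷⁺ {w} {L} (inj₂ (x⇝w , w⇝y)) = walk-++ (into x⇝w) (out w⇝y)
    where
    into : ∀ {x} → Reaches L x w → Walk E (_∈ₗ w ∷ L) x w
    into (inj₁ refl)        = start (here refl)
    into (inj₂ (_ , c , e)) = step (widen c) (here refl) e
    out : ∀ {y} → ReachedFrom L w y → Walk E (_∈ₗ w ∷ L) w y
    out (inj₁ refl)        = start (here refl)
    out (inj₂ (_ , e , c)) = walk-++ (step (start (here refl)) (there (walk-start c)) e) (widen c)

  walk-∷⁻ : ∀ {w L x y} → Walk E (_∈ₗ w ∷ L) x y →
            Walk E (_∈ₗ L) x y ⊎ Reaches L x w × ReachedFrom L w y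
  walk-∷⁻ (start (here refl))  = inj₂ (inj₁ refl , inj₁ refl)
  walk-∷⁻ (start (there x∈L)) = inj₁ (start x∈L)
  walk-∷⁻ (step c (here refl) e) with walk-∷⁻ c
  ... | inj₁ c′          = inj₂ (inj₂ (_ , c′ , e) , inj₁ refl)
  ... | inj₂ (x⇝w , _)  = inj₂ (x⇝w , inj₁ refl)
  walk-∷⁻ (step c (there z∈L) e) with walk-∷⁻ c
  ... | inj₁ c′                           = inj₁ (step c′ z∈L e)
  ... | inj₂ (x⇝w , inj₁ refl)            = inj₂ (x⇝w , inj₂ (_ , e , start z∈L))
  ... | inj₂ (x⇝w , inj₂ (p , e′ , c′))  = inj₂ (x⇝w , inj₂ (p , e′ , step c′ z∈L e))

  -- Floyd–Warshall style: allow one more intermediate vertex at a time.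
  walk? : ∀ L x y → Dec (Walk E (_∈ₗ L) x y)
  walk? []      x y = no (∉[] ∘ walk-end)
  walk? (w ∷ L) x y = map′ walk-∷⁺ walk-∷⁻ (walk? L x y ⊎-dec reaches? ×-dec reachedFrom?)
    where
    reaches?     = x ≟ w ⊎-dec any? (λ p → walk? L x p ×-dec E? p w)
    reachedFrom? = y ≟ w ⊎-dec any? (λ p → E? w p ×-dec walk? L p y)

members : ∀ {n} → Subset n → List (Fin n)
members []          = []
members (true ∷ p)  = zero ∷ map suc (members p)
members (false ∷ p) = map suc (members p)

∈-members⁺ : ∀ {n} {p : Subset n} {x} → x ∈ p → x ∈ₗ members p
∈-members⁺ {p = true ∷ _}  Vec.here        = here refl
∈-members⁺ {p = true ∷ _}  (Vec.there x∈p) = there (∈-map⁺ suc (∈-members⁺ x∈p))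
∈-members⁺ {p = false ∷ _} (Vec.there x∈p) = ∈-map⁺ suc (∈-members⁺ x∈p)

∈-members⁻ : ∀ {n} {p : Subset n} {x} → x ∈ₗ members p → x ∈ p
∈-members⁻ {p = true ∷ _} (here refl) = Vec.here
∈-members⁻ {p = true ∷ _} (there x∈) with ∈-map⁻ suc x∈
... | _ , y∈ , refl = Vec.there (∈-members⁻ y∈)
∈-members⁻ {p = false ∷ _} x∈ with ∈-map⁻ suc x∈
... | _ , y∈ , refl = Vec.there (∈-members⁻ y∈)

length-members : ∀ {n} (p : Subset n) → length (members p) ≡ ∣ p ∣
length-members []          = refl
length-members (true ∷ p)  = cong suc (trans (length-map suc (members p)) (length-members p))
length-members (false ∷ p) = trans (length-map suc (members p)) (length-members p)

module _ {n : ℕ} where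

  components : Subset n → (Fin n → Fin n → Bool) → Fin n → Fin n → Bool
  components S K x y = does (walk? (members S) x y)
    where open DecideWalk (λ u v → K u v Bool.≟ true)

  components-correct : ∀ {G S K} → (∀ x y → x ∈ S → y ∈ S → K x y ≡ adj G x y) →
                       CorrectComponents G S (components S K)
  components-correct {G} {S} {K} agree x y _ _ =
    Walk⇔Connected ⇔-∘ (walkK⇔walkG ⇔-∘ does≡true⇔ (walk? (members S) x y))
    where
    open DecideWalk (λ u v → K u v Bool.≟ true)
    walkK⇔walkG : Walk (λ u v → K u v ≡ true) (_∈ₗ members S) x y ⇔ Walk (Adj G) (_∈ S) x y
    walkK⇔walkG = mk⇔
      (walk-map ∈-members⁻ λ u∈ v∈ → trans (≡-sym (agree _ _ (∈-members⁻ u∈) (∈-members⁻ v∈))))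
      (walk-map ∈-members⁺ λ u∈ v∈ → trans (agree _ _ u∈ v∈))

∈-pair⁻ : ∀ {n} {u v z : Fin n} → z ∈ ⁅ u ⁆ ∪ ⁅ v ⁆ → z ≡ u ⊎ z ≡ v
∈-pair⁻ {u = u} {v} = Sum.map (x∈⁅y⁆⇒x≡y u) (x∈⁅y⁆⇒x≡y v) ∘ x∈p∪q⁻ ⁅ u ⁆ ⁅ v ⁆

pairAdjacency : ∀ {n} → Subset n → Fin n → Fin n → Bool
pairAdjacency R u v = not (lookup R u ∧ lookup R v)

module _ {n : ℕ} (G : Graph n) where

  ∈-MIS-of-nonadjacent-pair : ∀ {T R x y} → IsMIS G T R → x ∈ T →
                              (∀ z → z ∈ T → z ≡ x ⊎ z ≡ y) → adj G y x ≡ false → x ∈ R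
  ∈-MIS-of-nonadjacent-pair {R = R} {x} mis x∈T T⊆xy y≁x with x ∈? R
  ... | yes x∈R = x∈R
  ... | no x∉R with IsMIS.maximal mis x x∈T x∉R
  ...   | z , z∈R , z~x with T⊆xy z (IsMIS.subset mis z∈R)
  ...     | inj₁ refl = contradiction z~x (adj-irrefl G)
  ...     | inj₂ refl = contradiction (trans (≡-sym y≁x) z~x) λ ()

  pairAdjacency-correct : ∀ {u v R} → IsMIS G (⁅ u ⁆ ∪ ⁅ v ⁆) R → pairAdjacency R u v ≡ adj G u v
  pairAdjacency-correct {u} {v} {R} mis with adj G u v in u~v
  ... | true with lookup R u in u∈R | lookup R v in v∈R
  ...   | true  | true  = contradiction u~v
                            (IsMIS.independent mis u v (lookup⇒[]= u R u∈R) (lookup⇒[]= v R v∈R))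
  ...   | true  | false = refl
  ...   | false | _     = refl
  pairAdjacency-correct {u} {v} {R} mis | false
    rewrite []=⇒lookup (∈-MIS-of-nonadjacent-pair mis (x∈p∪q⁺ (inj₁ (x∈⁅x⁆ u))) (λ _ → ∈-pair⁻)
                          (trans (sym G v u) u~v))
          | []=⇒lookup (∈-MIS-of-nonadjacent-pair mis (x∈p∪q⁺ (inj₂ (x∈⁅x⁆ v)))
                          (λ _ → swap ∘ ∈-pair⁻) u~v)
          = refl

length-cartesianProduct : ∀ {A B : Set} (xs : List A) (ys : List B) →
                          length (cartesianProduct xs ys) ≡ length xs * length ys
length-cartesianProduct []       ys = refl
length-cartesianProduct (x ∷ xs) ys = begin
  length (map (x ,_) ys ++ cartesianProduct xs ys)
    ≡⟨ length-++ (map (x ,_) ys) ⟩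
  length (map (x ,_) ys) + length (cartesianProduct xs ys)
    ≡⟨ cong₂ _+_ (length-map (x ,_) ys) (length-cartesianProduct xs ys) ⟩
  length ys + length xs * length ys
    ∎
  where open ≡-Reasoning

module _ {n : ℕ} where

  _≟ₑ_ : (e e′ : Fin n × Fin n) → Dec (e ≡ e′)
  _≟ₑ_ = ≡-dec _≟_ _≟_

  assign : (Fin n → Fin n → Bool) → Fin n × Fin n → Bool → Fin n → Fin n → Bool
  assign K e b x y = if does ((x , y) ≟ₑ e) then b else K x y

  learnComponents : Subset n → List (Fin n × Fin n) → (Fin n → Fin n → Bool) → Alg n
  learnComponents S []             K = done (components S K)
  learnComponents S ((u , v) ∷ es) K = query (⁅ u ⁆ ∪ ⁅ v ⁆) λ R →
    learnComponents S es (assign K (u , v) (pairAdjacency R u v))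

  module _ (G : Graph n) (S : Subset n) where

    KnownExcept : List (Fin n × Fin n) → (Fin n → Fin n → Bool) → Set
    KnownExcept es K = ∀ x y → x ∈ S → y ∈ S → (x , y) ∈ₗ es ⊎ K x y ≡ adj G x y

    learnComponents-solves : ∀ {es K k} → KnownExcept es K → length es ≤ k →
                             SolvesWithin G S (learnComponents S es K) k
    learnComponents-solves {[]} known _ =
      done (components-correct λ x y x∈S y∈S → [ (λ ()) , id ]′ (known x y x∈S y∈S))
    learnComponents-solves {(u , v) ∷ es} {K} known (s≤s len) = query λ R mis →
      learnComponents-solves (known-assign (pairAdjacency-correct G mis)) len
      where
      known-assign : ∀ {b} → b ≡ adj G u v → KnownExcept es (assign K (u , v) b)
      known-assign b≡adj x y x∈S y∈S with (x , y) ≟ₑ (u , v)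
      ... | yes refl = inj₂ b≡adj
      ... | no xy≢uv with known x y x∈S y∈S
      ...   | inj₁ (here xy≡uv) = contradiction xy≡uv xy≢uv
      ...   | inj₁ (there xy∈es) = inj₁ xy∈es
      ...   | inj₂ Kxy≡adj = inj₂ Kxy≡adj

  componentsAlgorithm : Subset n → Alg n
  componentsAlgorithm S =
    learnComponents S (cartesianProduct (members S) (members S)) (λ _ _ → false)

  componentsAlgorithm-solves : ∀ G S {k} → ∣ S ∣ * ∣ S ∣ ≤ k →
                               SolvesWithin G S (componentsAlgorithm S) k
  componentsAlgorithm-solves G S |S|²≤k = learnComponents-solves G S
    (λ x y x∈S y∈S → inj₁ (∈-cartesianProduct⁺ (∈-members⁺ x∈S) (∈-members⁺ y∈S)))
    (subst (_≤ _) (≡-sym length-pairs) |S|²≤k)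
    where
    length-pairs : length (cartesianProduct (members S) (members S)) ≡ ∣ S ∣ * ∣ S ∣
    length-pairs = trans (length-cartesianProduct (members S) (members S))
                         (cong₂ _*_ (length-members S) (length-members S))

module _ {n : ℕ} (G : Graph n) (T : Subset n) where

  record IsMISOn (vs : List (Fin n)) (R : Subset n) : Set where
    field
      subset      : R ⊆ T
      independent : Independent G R
      maximal     : ∀ v → v ∈ₗ vs → v ∈ T → v ∉ R → Dominated G R v

  dominated? : ∀ R v → Dec (Dominated G R v)
  dominated? R v = any? λ u → u ∈? R ×-dec adj G u v Bool.≟ true

  private
    keep : ∀ {v vs R} → (v ∈ T → v ∉ R → Dominated G R v) → IsMISOn vs R → IsMISOn (v ∷ vs) R
    keep dom mis = record
      { subset      = subset
      ; independent = independent
      ; maximal     = λ { _ (here refl) → dom ; x (there x∈vs) → maximal x x∈vs }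
      }
      where open IsMISOn mis

    insert : ∀ {v vs R} → v ∈ T → ¬ Dominated G R v → IsMISOn vs R → IsMISOn (v ∷ vs) (R ∪ ⁅ v ⁆)
    insert {v} {vs} {R} v∈T undominated mis = record
      { subset      = λ x∈ → [ subset , (λ { refl → v∈T }) ]′ (∈-insert⁻ x∈)
      ; independent = independent′
      ; maximal     = maximal′
      }
      where
      open IsMISOn mis
      ∈-insert⁻ : ∀ {x} → x ∈ R ∪ ⁅ v ⁆ → x ∈ R ⊎ x ≡ v
      ∈-insert⁻ = Sum.map₂ (x∈⁅y⁆⇒x≡y v) ∘ x∈p∪q⁻ R ⁅ v ⁆
      R⊆R∪v : R ⊆ R ∪ ⁅ v ⁆
      R⊆R∪v = p⊆p∪q ⁅ v ⁆
      independent′ : Independent G (R ∪ ⁅ v ⁆)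
      independent′ x y x∈ y∈ x~y with ∈-insert⁻ x∈ | ∈-insert⁻ y∈
      ... | inj₁ x∈R | inj₁ y∈R = independent x y x∈R y∈R x~y
      ... | inj₁ x∈R | inj₂ refl = undominated (x , x∈R , x~y)
      ... | inj₂ refl | inj₁ y∈R = undominated (y , y∈R , adj-sym G x~y)
      ... | inj₂ refl | inj₂ refl = adj-irrefl G x~y
      maximal′ : ∀ x → x ∈ₗ v ∷ vs → x ∈ T → x ∉ R ∪ ⁅ v ⁆ → Dominated G (R ∪ ⁅ v ⁆) x
      maximal′ _ (here refl)  _   x∉ = contradiction (x∈p∪q⁺ (inj₂ (x∈⁅x⁆ v))) x∉
      maximal′ x (there x∈vs) x∈T x∉ with maximal x x∈vs x∈T (x∉ ∘ R⊆R∪v)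
      ... | u , u∈R , u~x = u , R⊆R∪v u∈R , u~x

  greedyMIS : ∀ vs → ∃ (IsMISOn vs)
  greedyMIS [] = ⊥ₛ , record
    { subset      = λ x∈⊥ → contradiction x∈⊥ ∉⊥
    ; independent = λ _ _ x∈⊥ → contradiction x∈⊥ ∉⊥
    ; maximal     = λ _ ()
    }
  greedyMIS (v ∷ vs) with greedyMIS vs
  ... | R , mis with v ∈? T | dominated? R v
  ...   | yes v∈T | no undominated = R ∪ ⁅ v ⁆ , insert v∈T undominated mis
  ...   | yes _   | yes dom        = R , keep (λ _ _ → dom) mis
  ...   | no v∉T  | _              = R , keep (λ v∈T → contradiction v∈T v∉T) mis

  ∃-MIS : ∃ (IsMIS G T)
  ∃-MIS with greedyMIS (allFin n)
  ... | R , mis = R , record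
    { subset      = subset
    ; independent = independent
    ; maximal     = λ v → maximal v (∈-allFin v)
    }
    where open IsMISOn mis

IsMIS-+edge : ∀ {n} {G : Graph n} {T R u v} → IsMIS G T R → ¬ (u ∈ R × v ∈ R) →
              IsMIS (G +edge (u , v)) T R
IsMIS-+edge {G = G} {T} {R} {u} {v} mis ¬both = record
  { subset      = subset
  ; independent = independent′
  ; maximal     = λ x x∈T x∉R →
      Product.map₂ (Product.map₂ (Equivalence.from (Adj-+edge G (u , v)) ∘ inj₁))
                   (maximal x x∈T x∉R)
  }
  where
  open IsMIS mis
  independent′ : Independent (G +edge (u , v)) R
  independent′ x y x∈R y∈R x~y with Equivalence.to (Adj-+edge G (u , v)) x~y
  ... | inj₁ x~₀y                       = independent x y x∈R y∈R x~₀y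
  ... | inj₂ (_ , inj₁ (refl , refl)) = ¬both (x∈R , y∈R)
  ... | inj₂ (_ , inj₂ (refl , refl)) = ¬both (y∈R , x∈R)

Spans : ∀ {n} → Subset n → Fin n × Fin n → Set
Spans R (u , v) = u ∈ R × v ∈ R

spans? : ∀ {n} R (e : Fin n × Fin n) → Dec (Spans R e)
spans? R (u , v) = u ∈? R ×-dec v ∈? R

length≤1+length-filter-∁ : ∀ {A : Set} {P : A → Set} (P? : ∀ x → Dec (P x)) {xs} → Unique xs →
                           (∀ {x y} → x ∈ₗ xs → y ∈ₗ xs → P x → P y → x ≡ y) →
                           length xs ≤ suc (length (filter (∁? P?) xs))
length≤1+length-filter-∁ P? {[]} _ _ = z≤n
length≤1+length-filter-∁ {P = P} P? {x ∷ xs} (x∉xs ∷ unique) P-unique with P? x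
... | yes Px = s≤s (≤-reflexive (cong length (≡-sym (filter-all (∁? P?) (All.tabulate ¬P)))))
  where
  ¬P : ∀ {y} → y ∈ₗ xs → ¬ P y
  ¬P y∈xs Py = All.lookup x∉xs y∈xs (P-unique (here refl) (there y∈xs) Px Py)
... | no ¬Px = s≤s (length≤1+length-filter-∁ P? unique λ x∈ y∈ → P-unique (there x∈) (there y∈))

module Adversary {n : ℕ} (G₀ : Graph n) (S : Subset n) (Candidate : Fin n × Fin n → Set)
  (candidate-separated : ∀ {u v} → Candidate (u , v) → u ∈ S × v ∈ S × ¬ Connected G₀ S u v)
  (candidate-unique : ∀ {R} → Independent G₀ R → ∀ {e e′} → Candidate e → Candidate e′ →
                      Spans R e → Spans R e′ → e ≡ e′)
  where

  distinguishes : ∀ {e out} → Candidate e → CorrectComponents G₀ S out →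
                  ¬ CorrectComponents (G₀ +edge e) S out
  distinguishes {u , v} cand correct₀ correct with candidate-separated cand
  ... | u∈S , v∈S , ¬connected₀ =
    ¬connected₀ (Equivalence.to (correct₀ u v u∈S v∈S)
                                (Equivalence.from (correct u v u∈S v∈S) connected))
    where
    u≢v : u ≢ v
    u≢v refl = ¬connected₀ (here u∈S)
    connected : Connected (G₀ +edge (u , v)) S u v
    connected = step (here u∈S) v∈S
      (Equivalence.from (Adj-+edge G₀ (u , v)) (inj₂ (u≢v , inj₁ (refl , refl))))

  queries≥candidates : ∀ {A k} → SolvesWithin G₀ S A k → ∀ es → Unique es →
                       All (λ e → Candidate e × SolvesWithin (G₀ +edge e) S A k) es → length es ≤ k
  queries≥candidates _ [] _ _ = z≤n
  queries≥candidates (done correct₀) (_ ∷ _) _ ((cand , done correct) ∷ _) =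
    contradiction correct (distinguishes cand correct₀)
  queries≥candidates (query {T} {f} {k} solves₀) es unique solves = ≤-trans
    (length≤1+length-filter-∁ (spans? R) unique λ e∈ e′∈ →
      candidate-unique (IsMIS.independent mis)
                       (proj₁ (All.lookup solves e∈)) (proj₁ (All.lookup solves e′∈)))
    (s≤s (queries≥candidates (solves₀ R mis) (filter (∁? (spans? R)) es) (Unique.filter⁺ _ unique)
      (All.map continue (All.zip (All.filter⁺ _ solves , All.all-filter _ es)))))
    where
    R = proj₁ (∃-MIS G₀ T)
    mis = proj₂ (∃-MIS G₀ T)
    continue : ∀ {e} →
               (Candidate e × SolvesWithin (G₀ +edge e) S (query T f) (suc k)) × ¬ Spans R e →
               Candidate e × SolvesWithin (G₀ +edge e) S (f R) k
    continue ((cand , query solves) , ¬spans) = cand , solves R (IsMIS-+edge mis ¬spans)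

module _ {n : ℕ} {c : Fin n → Bool} where

  Connected-twoCliques⇒sameColour : ∀ {S x y} → Connected (twoCliques c) S x y → c x ≡ c y
  Connected-twoCliques⇒sameColour (here _)         = refl
  Connected-twoCliques⇒sameColour (step {y} {z} xy _ y~z) =
    trans (Connected-twoCliques⇒sameColour xy) (proj₂ (Equivalence.to (Adj-twoCliques c y z) y~z))

  Independent-twoCliques : ∀ {R} → Independent (twoCliques c) R →
                           ∀ {x y} → x ∈ R → y ∈ R → c x ≡ c y → x ≡ y
  Independent-twoCliques independent {x} {y} x∈R y∈R cx≡cy = decidable-stable (x ≟ y) λ x≢y →
    independent x y x∈R y∈R (Equivalence.from (Adj-twoCliques c x y) (x≢y , cx≡cy))

  Crossing : Fin n × Fin n → Set
  Crossing (u , v) = c u ≡ true × c v ≡ false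

  twoCliques-queries≥crossings : ∀ {A k} → (∀ G → SolvesWithin G ⊤ A k) →
                                 ∀ {es} → Unique es → All Crossing es → length es ≤ k
  twoCliques-queries≥crossings solves {es} unique crossing =
    queries≥candidates (solves _) es unique (All.map (_, solves _) crossing)
    where
    separated : ∀ {u v} → Crossing (u , v) → u ∈ ⊤ × v ∈ ⊤ × ¬ Connected (twoCliques c) ⊤ u v
    separated (cu≡true , cv≡false) = ∈⊤ , ∈⊤ , λ uv →
      case trans (≡-sym cu≡true) (trans (Connected-twoCliques⇒sameColour uv) cv≡false) of λ ()
    spans-unique : ∀ {R} → Independent (twoCliques c) R → ∀ {e e′} → Crossing e → Crossing e′ →
                   Spans R e → Spans R e′ → e ≡ e′
    spans-unique independent (cu , cv) (cu′ , cv′) (u∈R , v∈R) (u′∈R , v′∈R) =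
      cong₂ _,_ (Independent-twoCliques independent u∈R u′∈R (trans cu (≡-sym cu′)))
                (Independent-twoCliques independent v∈R v′∈R (trans cv (≡-sym cv′)))
    open Adversary (twoCliques c) ⊤ Crossing separated spans-unique

module _ (q r : ℕ) where

  isLeft : Fin (q + r) → Bool
  isLeft x = [ const true , const false ]′ (splitAt q x)

  crossingEdges : List (Fin (q + r) × Fin (q + r))
  crossingEdges = map (λ (i , j) → i ↑ˡ r , q ↑ʳ j) (cartesianProduct (allFin q) (allFin r))

  crossingEdges-unique : Unique crossingEdges
  crossingEdges-unique = Unique.map⁺
    (λ { {i , j} {i′ , j′} eq → cong₂ _,_ (↑ˡ-injective r i i′ (,-injectiveˡ eq))
                                         (↑ʳ-injective q j j′ (,-injectiveʳ eq)) })
    (Unique.cartesianProduct⁺ (Unique.allFin⁺ q) (Unique.allFin⁺ r))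

  crossingEdges-crossing : All (Crossing {c = isLeft}) crossingEdges
  crossingEdges-crossing = All.map⁺ (All.tabulate λ { {i , j} _ →
    cong [ const true , const false ]′ (splitAt-↑ˡ q i r) ,
    cong [ const true , const false ]′ (splitAt-↑ʳ q r j) })

  length-crossingEdges : length crossingEdges ≡ q * r
  length-crossingEdges = begin
    length crossingEdges
      ≡⟨ length-map _ (cartesianProduct (allFin q) (allFin r)) ⟩
    length (cartesianProduct (allFin q) (allFin r))
      ≡⟨ length-cartesianProduct (allFin q) (allFin r) ⟩
    length (allFin q) * length (allFin r)
      ≡⟨ cong₂ _*_ (length-tabulate {n = q} id) (length-tabulate {n = r} id) ⟩
    q * r
      ∎
    where open ≡-Reasoning

  twoCliques-lowerBound : ∀ {A k} → (∀ G → SolvesWithin G ⊤ A k) → q * r ≤ k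
  twoCliques-lowerBound solves = subst (_≤ _) length-crossingEdges
    (twoCliques-queries≥crossings solves crossingEdges-unique crossingEdges-crossing)

⌈n/2⌉≤1+⌊n/2⌋ : ∀ n → ⌈ n /2⌉ ≤ suc ⌊ n /2⌋
⌈n/2⌉≤1+⌊n/2⌋ 0             = z≤n
⌈n/2⌉≤1+⌊n/2⌋ 1             = ≤-refl
⌈n/2⌉≤1+⌊n/2⌋ (suc (suc n)) = s≤s (⌈n/2⌉≤1+⌊n/2⌋ n)

n≤2*⌈n/2⌉ : ∀ n → n ≤ 2 * ⌈ n /2⌉
n≤2*⌈n/2⌉ n = begin
  n                       ≡⟨ ⌊n/2⌋+⌈n/2⌉≡n n ⟨
  ⌊ n /2⌋ + ⌈ n /2⌉       ≤⟨ +-monoˡ-≤ ⌈ n /2⌉ (⌊n/2⌋≤⌈n/2⌉ n) ⟩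
  ⌈ n /2⌉ + ⌈ n /2⌉       ≡⟨ cong (⌈ n /2⌉ +_) (+-identityʳ ⌈ n /2⌉) ⟨
  2 * ⌈ n /2⌉             ∎
  where open ≤-Reasoning

n≤3*⌊n/2⌋ : ∀ n → 2 ≤ n → n ≤ 3 * ⌊ n /2⌋
n≤3*⌊n/2⌋ n 2≤n = begin
  n                               ≡⟨ ⌊n/2⌋+⌈n/2⌉≡n n ⟨
  ⌊ n /2⌋ + ⌈ n /2⌉               ≤⟨ +-monoʳ-≤ ⌊ n /2⌋ (⌈n/2⌉≤1+⌊n/2⌋ n) ⟩
  ⌊ n /2⌋ + suc ⌊ n /2⌋           ≤⟨ +-monoʳ-≤ ⌊ n /2⌋ (+-monoˡ-≤ ⌊ n /2⌋ (⌊n/2⌋-mono 2≤n)) ⟩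
  ⌊ n /2⌋ + (⌊ n /2⌋ + ⌊ n /2⌋)
    ≡⟨ cong (λ m → ⌊ n /2⌋ + (⌊ n /2⌋ + m)) (+-identityʳ ⌊ n /2⌋) ⟨
  3 * ⌊ n /2⌋                     ∎
  where open ≤-Reasoning

n*n≤6*⌊n/2⌋*⌈n/2⌉ : ∀ n → 2 ≤ n → n * n ≤ 6 * (⌊ n /2⌋ * ⌈ n /2⌉)
n*n≤6*⌊n/2⌋*⌈n/2⌉ n 2≤n = begin
  n * n                         ≤⟨ *-mono-≤ (n≤3*⌊n/2⌋ n 2≤n) (n≤2*⌈n/2⌉ n) ⟩
  (3 * ⌊ n /2⌋) * (2 * ⌈ n /2⌉) ≡⟨ rearrange ⌊ n /2⌋ ⌈ n /2⌉ ⟩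
  6 * (⌊ n /2⌋ * ⌈ n /2⌉)       ∎
  where
  open ≤-Reasoning
  rearrange : ∀ a b → (3 * a) * (2 * b) ≡ 6 * (a * b)
  rearrange = solve-∀

theorem16 :
    -- upper bound: O(|S|^2) MIS queries suffice, for every vertex set and S ⊆ V
    Σ ℕ (λ c → (n : ℕ) → (S : Subset n) →
      Σ (Alg n) (λ A → (G : Graph n) → SolvesWithin G S A (c * ∣ S ∣ ^ 2 + c)))
    ×
    -- lower bound: Ω(|S|^2) MIS queries are needed on some instances
    Σ ℕ (λ d → Σ ℕ (λ N → (m : ℕ) → N ≤ m →
      Σ ℕ (λ n → Σ (Subset n) (λ S → ∣ S ∣ ≡ m ×
        ((A : Alg n) → (k : ℕ) → ((G : Graph n) → SolvesWithin G S A k) →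
          m * m ≤ d * k)))))
theorem16 =
  (1 , λ n S → componentsAlgorithm S , λ G →
    componentsAlgorithm-solves G S (subst (_≤ 1 * ∣ S ∣ ^ 2 + 1) (square ∣ S ∣) (m≤m+n _ 1))) ,
  (6 , 2 , λ m 2≤m → ⌊ m /2⌋ + ⌈ m /2⌉ , ⊤ , trans (∣⊤∣≡n _) (⌊n/2⌋+⌈n/2⌉≡n m) , λ A k solves →
    ≤-trans (n*n≤6*⌊n/2⌋*⌈n/2⌉ m 2≤m) (*-monoʳ-≤ 6 (twoCliques-lowerBound ⌊ m /2⌋ ⌈ m /2⌉ solves)))
  where
  square : ∀ s → 1 * s ^ 2 ≡ s * s
  square s = trans (*-identityˡ (s ^ 2)) (cong (s *_) (^-identityʳ s))
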